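{- Let $\ell,q\ge 1$. Let $T$ be the graph obtained from the star $K_{1,2q}$ with center $c$ and leaves $u_1,\dots,u_{2q}$ as follows: for each edge $(c,u_j)$ add $4\ell$ new vertices, each adjacent to exactly $c$ and $u_j$, and delete the edge $(c,u_j)$. Let $$g_{\ell,q}(x,y,z)=y(yx^2+1)^{4\ell}+(yx+z)^{4\ell},\qquad h_{\ell,q}(x,y,z)=(y+z^2)^{4\ell}+y(yx+z)^{4\ell}.$$ Then $$Z(T,\{c\},\emptyset;x,y,z)=\big(g_{\ell,q}(x,y,z)\big)^{2q},\qquad Z(T,\emptyset,\{c\};x,y,z)=\big(h_{\ell,q}(x,y,z)\big)^{2q}.$$
   Context: For a simple graph $H$ and disjoint $B,C\subseteq V(H)$, $Z(H,B,C;x,y,z)=\sum_{A:\,B\subseteq A\subseteq V(H),\,A\cap C=\emptyset} x^{|E_H(A)|}\,y^{|A\setminus B|}\,z^{|E_H(\bar A)|}$, where $\bar A=V(H)\setminus A$ and $E_H(A)$ (resp. $E_H(\bar A)$) is the set of edges with both endpoints in $A$ (resp. $\bar A$). Vertices of $B$ contribute no factor $y$. -}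

module Defs where

open import Data.Bool using (Bool; true; false; _∧_; _∨_; not; if_then_else_)
open import Data.Nat as ℕ using (ℕ; zero; suc; _<ᵇ_)
open import Data.Fin as Fin using (Fin; zero; suc; toℕ; splitAt; remQuot; _≟_)
open import Data.Sum using (inj₁; inj₂)
open import Data.Product using (_,_)
open import Data.List using (List; []; _∷_; map; _++_; foldr)
open import Data.Vec using (Vec; []; _∷_; lookup)
open import Relation.Nullary.Decidable using (⌊_⌋; yes; no)
open import Data.Empty using (⊥-elim)
import Data.Vec
import Relation.Binary.PropositionalEquality as Eq
open import Relation.Binary.PropositionalEquality using (_≡_; refl)
open import Algebra.Bundles using (CommutativeSemiring)

record Graph : Set where
  field
    n     : ℕ
    adj   : Fin n → Fin n → Bool
    sym   : ∀ i j → adj i j ≡ adj j i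
    irref : ∀ i → adj i i ≡ false

open Graph public

VSet : ℕ → Set
VSet n = Vec Bool n

_∈ᵇ_ : ∀ {n} → Fin n → VSet n → Bool
i ∈ᵇ A = lookup A i

allSubsets : ∀ n → List (VSet n)
allSubsets zero    = [] ∷ []
allSubsets (suc n) = map (false ∷_) (allSubsets n) ++ map (true ∷_) (allSubsets n)

count : ∀ n → (Fin n → Bool) → ℕ
count zero    P = 0
count (suc n) P = (if P zero then 1 else 0) ℕ.+ count n (λ i → P (suc i))

-- B ⊆ A and A ∩ C = ∅, decided
admissible : ∀ {n} → VSet n → VSet n → VSet n → Bool
admissible {n} B C A =
  ⌊ count n (λ i → (i ∈ᵇ B ∧ not (i ∈ᵇ A)) ∨ (i ∈ᵇ C ∧ i ∈ᵇ A)) ℕ.≟ 0 ⌋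

compl : ∀ {n} → VSet n → VSet n
compl []      = []
compl (b ∷ A) = not b ∷ compl A

sumFin : ∀ n → (Fin n → ℕ) → ℕ
sumFin zero    f = 0
sumFin (suc n) f = f zero ℕ.+ sumFin n (λ i → f (suc i))

edgesIn : (H : Graph) → VSet (n H) → ℕ
edgesIn H S = sumFin (n H) (λ i → count (n H) (λ j →
  (toℕ i <ᵇ toℕ j) ∧ adj H i j ∧ i ∈ᵇ S ∧ j ∈ᵇ S))

diffSize : ∀ {n} → VSet n → VSet n → ℕ
diffSize {n} A B = count n (λ i → i ∈ᵇ A ∧ not (i ∈ᵇ B))

-- The polynomial Z(H,B,C;x,y,z), evaluated in an arbitrary commutative
-- semiring (an identity for all commutative semirings and all x y z is
-- the same as an identity of polynomials with integer coefficients,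
-- taking R = ℕ[x,y,z]).

module _ {c ℓ} (R : CommutativeSemiring c ℓ) where
  open CommutativeSemiring R

  pow : Carrier → ℕ → Carrier
  pow a zero    = 1#
  pow a (suc k) = a * pow a k

  Z : (H : Graph) → VSet (n H) → VSet (n H) → Carrier → Carrier → Carrier → Carrier
  Z H B C x y z = foldr _+_ 0# (map term (allSubsets (n H)))
    where
    term : VSet (n H) → Carrier
    term A = if admissible B C A
             then pow x (edgesIn H A) * pow y (diffSize A B) * pow z (edgesIn H (compl A))
             else 0#

data Kind (q ℓ : ℕ) : Set where
  center : Kind q ℓ
  leaf   : Fin (2 ℕ.* q) → Kind q ℓ
  mid    : Fin (2 ℕ.* q) → Fin (4 ℕ.* ℓ) → Kind q ℓ

Tsize : ℕ → ℕ → ℕ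
Tsize ℓ q = 1 ℕ.+ (2 ℕ.* q ℕ.+ (2 ℕ.* q) ℕ.* (4 ℕ.* ℓ))

-- vertex numbering: 0 = c, then the leaves, then the w_{j,k}
decode : ∀ ℓ q → Fin (Tsize ℓ q) → Kind q ℓ
decode ℓ q v with splitAt 1 v
... | inj₁ _ = center
... | inj₂ v′ with splitAt (2 ℕ.* q) v′
...   | inj₁ j = leaf j
...   | inj₂ w with remQuot {2 ℕ.* q} (4 ℕ.* ℓ) w
...     | (j , k) = mid j k

kadj : ∀ {q ℓ} → Kind q ℓ → Kind q ℓ → Bool
kadj center    (mid _ _)  = true
kadj (mid _ _) center     = true
kadj (leaf j)  (mid j′ _) = ⌊ j ≟ j′ ⌋
kadj (mid j _) (leaf j′)  = ⌊ j ≟ j′ ⌋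
kadj _         _          = false

kadj-sym : ∀ {q ℓ} (a b : Kind q ℓ) → kadj a b ≡ kadj b a
kadj-sym center    center     = refl
kadj-sym center    (leaf _)   = refl
kadj-sym center    (mid _ _)  = refl
kadj-sym (leaf _)  center     = refl
kadj-sym (leaf _)  (leaf _)   = refl
kadj-sym (leaf j)  (mid j′ _) with j ≟ j′ | j′ ≟ j
... | yes _ | yes _ = refl
... | no  _ | no  _ = refl
... | yes p | no ¬p = ⊥-elim (¬p (Eq.sym p))
... | no ¬p | yes p = ⊥-elim (¬p (Eq.sym p))
kadj-sym (mid _ _) center     = refl
kadj-sym (mid j _) (leaf j′)  with j ≟ j′ | j′ ≟ j
... | yes _ | yes _ = refl
... | no  _ | no  _ = refl
... | yes p | no ¬p = ⊥-elim (¬p (Eq.sym p))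
... | no ¬p | yes p = ⊥-elim (¬p (Eq.sym p))
kadj-sym (mid _ _) (mid _ _)  = refl

kadj-irr : ∀ {q ℓ} (a : Kind q ℓ) → kadj a a ≡ false
kadj-irr center    = refl
kadj-irr (leaf _)  = refl
kadj-irr (mid _ _) = refl

T : ℕ → ℕ → Graph
T ℓ q = record
  { n     = Tsize ℓ q
  ; adj   = λ u v → kadj (decode ℓ q u) (decode ℓ q v)
  ; sym   = λ u v → kadj-sym (decode ℓ q u) (decode ℓ q v)
  ; irref = λ u → kadj-irr (decode ℓ q u)
  }

cT : ∀ ℓ q → Fin (Tsize ℓ q)
cT ℓ q = zero

singleton : ∀ {n} → Fin n → VSet n
singleton {suc n} zero    = true ∷ emptySet
  where emptySet = Data.Vec.replicate n false
singleton {suc n} (suc i) = false ∷ singleton i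

∅ : ∀ {n} → VSet n
∅ {n} = Data.Vec.replicate n false

module _ {c ℓ′} (R : CommutativeSemiring c ℓ′) where
  open CommutativeSemiring R

  g : ℕ → Carrier → Carrier → Carrier → Carrier
  g ℓ x y z = y * pow R (y * pow R x 2 + 1#) (4 ℕ.* ℓ) + pow R (y * x + z) (4 ℕ.* ℓ)

  h : ℕ → Carrier → Carrier → Carrier → Carrier
  h ℓ x y z = pow R (y + pow R z 2) (4 ℕ.* ℓ) + y * pow R (y * x + z) (4 ℕ.* ℓ)

-- Fixing B and C fixes whether the center c lies in A. Every edge of T joins a middle vertex
-- to c or to that vertex's leaf, so T − c is a disjoint union of 2q stars (a leaf with its 4ℓ
-- middle vertices). With the state of c fixed, the weight x^|E(A)| y^|A∖B| z^|E(Ā)| is a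
-- product over these stars and, within a star, once the state l of the leaf is fixed, a
-- product over the middle vertices. Summing the independent choices, each star contributes
-- Σ_l y^[l] (φ_l(w ∉ A) + φ_l(w ∈ A))^{4ℓ}, where φ_l(w) is the weight of a middle vertex
-- with its two edges; this sum is g when c ∈ A and h when c ∉ A.

module Submission where

open import Defs hiding (sym)
open import Algebra.Bundles using (Monoid; CommutativeSemiring)
open import Data.Bool using (Bool; true; false; _∧_; _∨_; not; if_then_else_)
open import Data.Bool.Properties using (∧-zeroʳ; ∧-identityʳ; ∧-inverseˡ; ∧-inverseʳ)
open import Data.Fin using (Fin; zero; suc; toℕ; _↑ˡ_; _↑ʳ_; combine; remQuot; _≟_)
open import Data.Fin.Properties using (splitAt-↑ˡ; splitAt-↑ʳ; remQuot-combine)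
open import Data.Nat using (ℕ; zero; suc; _<ᵇ_; _≥_)
import Data.Nat as ℕ
open import Data.Nat.Properties using (+-0-monoid; +-0-commutativeMonoid)
open import Data.Product using (_×_; _,_; uncurry)
open import Data.List using (List; []; _∷_; _++_; map; foldr)
open import Data.Vec using (_∷_; lookup; replicate) renaming (_++_ to _++ᵥ_)
open import Data.Vec.Properties using (lookup-replicate; lookup-++ˡ; lookup-++ʳ)
open import Function using (_∘_)
open import Relation.Nullary.Decidable using (⌊_⌋; ⌊⌋-map′)
open import Relation.Binary.PropositionalEquality as ≡
  using (_≡_; refl; cong; cong₂; module ≡-Reasoning)

-- ℕ arithmetic is opened only in this block; afterwards _+_ and _*_ are the semiring's.
module _ where
  open import Data.Nat using (_+_; _*_)
  open import Data.Nat.Properties using (+-identityʳ)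

  indicator : Bool → ℕ
  indicator b = if b then 1 else 0

  module _ {a ℓ} (M : Monoid a ℓ) where
    open Monoid M renaming (refl to ≈-refl)
    open import Algebra.Properties.Monoid.Sum M

    sum-↑ : ∀ m n (f : Fin (m + n) → Carrier) →
            sum f ≈ sum (f ∘ (_↑ˡ n)) ∙ sum (f ∘ (m ↑ʳ_))
    sum-↑ zero    n f = sym (identityˡ _)
    sum-↑ (suc m) n f = trans (∙-congˡ (sum-↑ m n (f ∘ suc))) (sym (assoc _ _ _))

    sum-combine : ∀ m n (f : Fin (m * n) → Carrier) →
                  sum f ≈ ∑[ i < m ] ∑[ j < n ] f (combine i j)
    sum-combine zero    n f = ≈-refl
    sum-combine (suc m) n f =
      trans (sum-↑ n (m * n) f) (∙-congˡ (sum-combine m n (f ∘ (n ↑ʳ_))))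

  open import Algebra.Properties.CommutativeMonoid.Sum +-0-commutativeMonoid
    using (sum; sum-syntax; sum-cong-≗; sum-replicate-zero; ∑-comm; ∑-distrib-+)

  sumFin≡sum : ∀ n (f : Fin n → ℕ) → sumFin n f ≡ sum f
  sumFin≡sum zero    f = refl
  sumFin≡sum (suc n) f = cong (f zero +_) (sumFin≡sum n (f ∘ suc))

  count≡sum : ∀ n (P : Fin n → Bool) → count n P ≡ ∑[ i < n ] indicator (P i)
  count≡sum zero    P = refl
  count≡sum (suc n) P = cong (indicator (P zero) +_) (count≡sum n (P ∘ suc))

  ∑-zero : ∀ {n} {f : Fin n → ℕ} → (∀ i → f i ≡ 0) → sum f ≡ 0
  ∑-zero {n} f≡0 = ≡.trans (sum-cong-≗ f≡0) (sum-replicate-zero n)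

  ∑-δ : ∀ {n} (j : Fin n) (b : Fin n → Bool) →
        ∑[ i < n ] indicator (⌊ j ≟ i ⌋ ∧ b i) ≡ indicator (b j)
  ∑-δ {suc n} zero    b =
    ≡.trans (cong (indicator (b zero) +_) (sum-replicate-zero n)) (+-identityʳ _)
  ∑-δ {suc n} (suc j) b = ≡.trans
    (sum-cong-≗ λ i → cong (λ t → indicator (t ∧ b (suc i))) (⌊⌋-map′ _ _ (j ≟ i)))
    (∑-δ j (b ∘ suc))

  ↑ˡ<ᵇ↑ʳ : ∀ {m} (i : Fin m) n (w : Fin n) → (toℕ (i ↑ˡ n) <ᵇ toℕ (m ↑ʳ w)) ≡ true
  ↑ˡ<ᵇ↑ʳ zero    n w = refl
  ↑ˡ<ᵇ↑ʳ (suc i) n w = ↑ˡ<ᵇ↑ʳ i n w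

  ↑ʳ<ᵇ↑ˡ : ∀ {m} (i : Fin m) n (w : Fin n) → (toℕ (m ↑ʳ w) <ᵇ toℕ (i ↑ˡ n)) ≡ false
  ↑ʳ<ᵇ↑ˡ zero    n w = refl
  ↑ʳ<ᵇ↑ˡ (suc i) n w = ↑ʳ<ᵇ↑ˡ i n w

  lookup-compl : ∀ {n} (A : VSet n) i → lookup (compl A) i ≡ not (lookup A i)
  lookup-compl (b ∷ A) zero    = refl
  lookup-compl (b ∷ A) (suc i) = lookup-compl A i

  count-none : ∀ n (P : Fin n → Bool) → (∀ i → P i ≡ false) → count n P ≡ 0
  count-none n P none = ≡.trans (count≡sum n P) (∑-zero (cong indicator ∘ none))

  edgesIn≡∑∑ : ∀ H (S : VSet (n H)) → edgesIn H S ≡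
    ∑[ i < n H ] ∑[ j < n H ] indicator ((toℕ i <ᵇ toℕ j) ∧ adj H i j ∧ i ∈ᵇ S ∧ j ∈ᵇ S)
  edgesIn≡∑∑ H S = ≡.trans (sumFin≡sum (n H) _) (sum-cong-≗ λ i → count≡sum (n H) (arc i))
    where
    arc : Fin (n H) → Fin (n H) → Bool
    arc i j = (toℕ i <ᵇ toℕ j) ∧ adj H i j ∧ i ∈ᵇ S ∧ j ∈ᵇ S

  -- centerIf true and centerIf false are, definitionally, singleton zero and ∅.
  centerIf : ∀ {n} → Bool → VSet (suc n)
  centerIf {n} b = b ∷ replicate n false

  admissible-in : ∀ {n} b (A : VSet n) → admissible (centerIf b) (centerIf (not b)) (b ∷ A) ≡ true
  admissible-in {n} b A = cong (λ m → ⌊ m ℕ.≟ 0 ⌋) (count-none (suc n) _ no-violation)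
    where
    no-violation : ∀ i → (i ∈ᵇ centerIf b ∧ not (i ∈ᵇ (b ∷ A)))
                         ∨ (i ∈ᵇ centerIf (not b) ∧ i ∈ᵇ (b ∷ A)) ≡ false
    no-violation zero    = cong₂ _∨_ (∧-inverseʳ b) (∧-inverseˡ b)
    no-violation (suc i) = cong (λ t → (t ∧ not (lookup A i)) ∨ (t ∧ lookup A i))
                                (lookup-replicate i false)

  admissible-out : ∀ {n} b (A : VSet n) →
    admissible (centerIf b) (centerIf (not b)) (not b ∷ A) ≡ false
  admissible-out true  A = refl
  admissible-out false A = refl

  gadgetEdges : ∀ {K} → Bool → Bool → (Fin K → Bool) → ℕ
  gadgetEdges {K} a l μ = ∑[ k < K ] (indicator (a ∧ μ k) + indicator (l ∧ μ k))

  gadgetSize : ∀ {K} → Bool → (Fin K → Bool) → ℕ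
  gadgetSize {K} l μ = indicator l + ∑[ k < K ] indicator (μ k)

  module _ (ℓ q : ℕ) where
    private
      p K : ℕ
      p = 2 * q
      K = 4 * ℓ
      V : Set
      V = Fin (Tsize ℓ q)

    leafV : Fin p → V
    leafV j = suc (j ↑ˡ (p * K))

    midV : Fin p → Fin K → V
    midV j k = suc (p ↑ʳ combine j k)

    decode-leafV : ∀ j → decode ℓ q (leafV j) ≡ leaf j
    decode-leafV j rewrite splitAt-↑ˡ p j (p * K) = refl

    decode-midV : ∀ j k → decode ℓ q (midV j k) ≡ mid j k
    decode-midV j k rewrite splitAt-↑ʳ p (p * K) (combine j k) =
      cong (uncurry mid) (remQuot-combine {p} {K} j k)

    sum-T : (f : V → ℕ) →
            sum f ≡ f zero + (∑[ j < p ] f (leafV j) + ∑[ j < p ] ∑[ k < K ] f (midV j k))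
    sum-T f = cong (f zero +_) (≡.trans (sum-↑ +-0-monoid p (p * K) (f ∘ suc))
      (cong (∑[ j < p ] f (leafV j) +_) (sum-combine +-0-monoid p K (λ w → f (suc (p ↑ʳ w))))))

    sum-decode : (F : V → Kind q ℓ → ℕ) →
                 ∑[ v < Tsize ℓ q ] F v (decode ℓ q v)
                 ≡ F zero center + (∑[ j < p ] F (leafV j) (leaf j)
                                    + ∑[ j < p ] ∑[ k < K ] F (midV j k) (mid j k))
    sum-decode F = ≡.trans (sum-T (λ v → F v (decode ℓ q v)))
      (cong₂ (λ s t → F zero center + (s + t))
        (sum-cong-≗ λ j → cong (F (leafV j)) (decode-leafV j))
        (sum-cong-≗ λ j → sum-cong-≗ λ k → cong (F (midV j k)) (decode-midV j k)))

    -- edgesIn counts every edge at its smaller endpoint. Middle vertices are numbered last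
    -- and every edge has a middle endpoint, so only the rows of the center and the leaves
    -- contribute. The kind of the row vertex is a separate argument so that sum-decode can
    -- substitute it.
    module _ (α : V → Bool) where

      forwardArc : V → Kind q ℓ → V → Kind q ℓ → ℕ
      forwardArc i κ v κ′ = indicator ((toℕ i <ᵇ toℕ v) ∧ kadj κ κ′ ∧ α i ∧ α v)

      forwardDegree : V → Kind q ℓ → ℕ
      forwardDegree i κ = ∑[ v < Tsize ℓ q ] forwardArc i κ v (decode ℓ q v)

      forwardDegree-center :
        forwardDegree zero center ≡ ∑[ j < p ] ∑[ k < K ] indicator (α zero ∧ α (midV j k))
      forwardDegree-center = ≡.trans (sum-decode (forwardArc zero center))
        (cong (_+ ∑[ j < p ] ∑[ k < K ] indicator (α zero ∧ α (midV j k))) (sum-replicate-zero p))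

      forwardDegree-leaf : ∀ j →
        forwardDegree (leafV j) (leaf j) ≡ ∑[ k < K ] indicator (α (leafV j) ∧ α (midV j k))
      forwardDegree-leaf j = begin
        forwardDegree (leafV j) (leaf j)
          ≡⟨ sum-decode (forwardArc (leafV j) (leaf j)) ⟩
        ∑[ j′ < p ] forwardArc (leafV j) (leaf j) (leafV j′) (leaf j′)
          + ∑[ j′ < p ] ∑[ k < K ] forwardArc (leafV j) (leaf j) (midV j′ k) (mid j′ k)
          ≡⟨ cong₂ _+_ (∑-zero λ j′ → cong indicator (∧-zeroʳ (toℕ (leafV j) <ᵇ toℕ (leafV j′))))
                       (sum-cong-≗ λ j′ → sum-cong-≗ λ k →
                          cong (λ t → indicator (t ∧ ⌊ j ≟ j′ ⌋ ∧ α (leafV j) ∧ α (midV j′ k)))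
                               (↑ˡ<ᵇ↑ʳ j (p * K) (combine j′ k))) ⟩
        ∑[ j′ < p ] ∑[ k < K ] indicator (⌊ j ≟ j′ ⌋ ∧ α (leafV j) ∧ α (midV j′ k))
          ≡⟨ ∑-comm (λ j′ k → indicator (⌊ j ≟ j′ ⌋ ∧ α (leafV j) ∧ α (midV j′ k))) ⟩
        ∑[ k < K ] ∑[ j′ < p ] indicator (⌊ j ≟ j′ ⌋ ∧ α (leafV j) ∧ α (midV j′ k))
          ≡⟨ sum-cong-≗ (λ k → ∑-δ j (λ j′ → α (leafV j) ∧ α (midV j′ k))) ⟩
        ∑[ k < K ] indicator (α (leafV j) ∧ α (midV j k)) ∎
        where open ≡-Reasoning

      forwardDegree-mid : ∀ j k → forwardDegree (midV j k) (mid j k) ≡ 0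
      forwardDegree-mid j k = ≡.trans (sum-decode (forwardArc (midV j k) (mid j k))) (cong₂ _+_
        (∑-zero {p} λ j′ → cong (λ t → indicator (t ∧ ⌊ j ≟ j′ ⌋ ∧ α (midV j k) ∧ α (leafV j′)))
                                (↑ʳ<ᵇ↑ˡ {p} j′ (p * K) (combine j k)))
        (∑-zero {p} λ j′ → ∑-zero {K} λ k′ → cong indicator (∧-zeroʳ _)))

    edgesIn-T : ∀ A → let α = lookup A in
      edgesIn (T ℓ q) A ≡ ∑[ j < p ] gadgetEdges (α zero) (α (leafV j)) (λ k → α (midV j k))
    edgesIn-T A = begin
      edgesIn (T ℓ q) A
        ≡⟨ edgesIn≡∑∑ (T ℓ q) A ⟩
      ∑[ i < Tsize ℓ q ] forwardDegree α i (decode ℓ q i)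
        ≡⟨ sum-decode (forwardDegree α) ⟩
      forwardDegree α zero center + (∑[ j < p ] forwardDegree α (leafV j) (leaf j) + midRows)
        ≡⟨ cong₂ (λ s t → s + (t + midRows))
                 (forwardDegree-center α) (sum-cong-≗ (forwardDegree-leaf α)) ⟩
      ∑[ j < p ] centerArcs j + (∑[ j < p ] leafArcs j + midRows)
        ≡⟨ cong (λ t → ∑[ j < p ] centerArcs j + (∑[ j < p ] leafArcs j + t))
                (∑-zero λ j → ∑-zero (forwardDegree-mid α j)) ⟩
      ∑[ j < p ] centerArcs j + (∑[ j < p ] leafArcs j + 0)
        ≡⟨ cong (∑[ j < p ] centerArcs j +_) (+-identityʳ _) ⟩
      ∑[ j < p ] centerArcs j + ∑[ j < p ] leafArcs j
        ≡⟨ ≡.sym (∑-distrib-+ centerArcs leafArcs) ⟩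
      ∑[ j < p ] (centerArcs j + leafArcs j)
        ≡⟨ sum-cong-≗ (λ j → ≡.sym (∑-distrib-+ (λ k → indicator (α zero ∧ α (midV j k)))
                                                (λ k → indicator (α (leafV j) ∧ α (midV j k))))) ⟩
      ∑[ j < p ] gadgetEdges (α zero) (α (leafV j)) (λ k → α (midV j k)) ∎
      where
      open ≡-Reasoning
      α = lookup A
      centerArcs leafArcs : Fin p → ℕ
      centerArcs j = ∑[ k < K ] indicator (α zero ∧ α (midV j k))
      leafArcs j = ∑[ k < K ] indicator (α (leafV j) ∧ α (midV j k))
      midRows = ∑[ j < p ] ∑[ k < K ] forwardDegree α (midV j k) (mid j k)

    diffSize-T : ∀ b (A : VSet (Tsize ℓ q)) → let α = lookup A in
      diffSize A (centerIf b)
      ≡ indicator (α zero ∧ not b) + ∑[ j < p ] gadgetSize (α (leafV j)) (λ k → α (midV j k))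
    diffSize-T b A = begin
      diffSize A (centerIf b)
        ≡⟨ count≡sum (Tsize ℓ q) (λ i → α i ∧ not (lookup (b ∷ rest) i)) ⟩
      ∑[ i < Tsize ℓ q ] indicator (α i ∧ not (lookup (b ∷ rest) i))
        ≡⟨ sum-T (λ i → indicator (α i ∧ not (lookup (b ∷ rest) i))) ⟩
      indicator (α zero ∧ not b)
        + (∑[ j < p ] indicator (α (leafV j) ∧ not (lookup rest (j ↑ˡ (p * K))))
           + ∑[ j < p ] ∑[ k < K ] indicator (α (midV j k) ∧ not (lookup rest (p ↑ʳ combine j k))))
        ≡⟨ cong₂ (λ s t → indicator (α zero ∧ not b) + (s + t))
                 (sum-cong-≗ {p} λ j → outside-B (j ↑ˡ (p * K)))
                 (sum-cong-≗ {p} λ j → sum-cong-≗ {K} λ k → outside-B (p ↑ʳ combine j k)) ⟩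
      indicator (α zero ∧ not b)
        + (∑[ j < p ] indicator (α (leafV j)) + ∑[ j < p ] ∑[ k < K ] indicator (α (midV j k)))
        ≡⟨ cong (indicator (α zero ∧ not b) +_)
                (≡.sym (∑-distrib-+ (λ j → indicator (α (leafV j)))
                                    (λ j → ∑[ k < K ] indicator (α (midV j k))))) ⟩
      indicator (α zero ∧ not b) + ∑[ j < p ] gadgetSize (α (leafV j)) (λ k → α (midV j k)) ∎
      where
      open ≡-Reasoning
      α = lookup A
      rest = replicate (p + p * K) false
      outside-B : ∀ i → indicator (α (suc i) ∧ not (lookup rest i)) ≡ indicator (α (suc i))
      outside-B i = cong indicator
        (≡.trans (cong (λ t → α (suc i) ∧ not t) (lookup-replicate i false)) (∧-identityʳ (α (suc i))))

    edgesIn-compl-T : ∀ A → let α = lookup A in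
      edgesIn (T ℓ q) (compl A)
      ≡ ∑[ j < p ] gadgetEdges (not (α zero)) (not (α (leafV j))) (λ k → not (α (midV j k)))
    edgesIn-compl-T A = ≡.trans (edgesIn-T (compl A)) (sum-cong-≗ λ j → sum-cong-≗ λ k →
      cong₂ _+_ (cong indicator (cong₂ _∧_ (¬A zero) (¬A (midV j k))))
                (cong indicator (cong₂ _∧_ (¬A (leafV j)) (¬A (midV j k)))))
      where ¬A = lookup-compl A

module _ {c ℓ′} (R : CommutativeSemiring c ℓ′) where
  open CommutativeSemiring R hiding (zero) renaming (refl to ≈-refl)
  open import Algebra.Properties.CommutativeMonoid.Sum *-commutativeMonoid
    using () renaming (sum to ∏; sum-cong-≋ to ∏-cong; ∑-distrib-+ to ∏-distrib-*)
  open import Algebra.Properties.CommutativeMonoid.Sum +-0-commutativeMonoid using (sum; sum-syntax)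
  open import Relation.Binary.Reasoning.Setoid setoid
  import Algebra.Solver.CommutativeMonoid *-commutativeMonoid as *-Solver
  open import Algebra.Solver.Ring.NaturalCoefficients.Default R using (solve; _:=_; con; _:+_; _:*_)

  pow-+ : ∀ a m n → pow R a (m ℕ.+ n) ≈ pow R a m * pow R a n
  pow-+ a zero    n = sym (*-identityˡ _)
  pow-+ a (suc m) n = trans (*-congˡ (pow-+ a m n)) (sym (*-assoc _ _ _))

  pow-cong : ∀ n {a b} → a ≈ b → pow R a n ≈ pow R b n
  pow-cong zero    a≈b = ≈-refl
  pow-cong (suc n) a≈b = *-cong a≈b (pow-cong n a≈b)

  ∏-const : ∀ n a → ∏ {n} (λ _ → a) ≈ pow R a n
  ∏-const zero    a = ≈-refl
  ∏-const (suc n) a = *-congˡ (∏-const n a)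

  sumList : ∀ {A : Set} → List A → (A → Carrier) → Carrier
  sumList xs f = foldr _+_ 0# (map f xs)

  module _ {A : Set} where

    sumList-cong : ∀ (xs : List A) {f g} → (∀ a → f a ≈ g a) → sumList xs f ≈ sumList xs g
    sumList-cong []       f≈g = ≈-refl
    sumList-cong (a ∷ xs) f≈g = +-cong (f≈g a) (sumList-cong xs f≈g)

    sumList-++ : ∀ (xs ys : List A) f → sumList (xs ++ ys) f ≈ sumList xs f + sumList ys f
    sumList-++ []       ys f = sym (+-identityˡ _)
    sumList-++ (a ∷ xs) ys f = trans (+-congˡ (sumList-++ xs ys f)) (sym (+-assoc _ _ _))

    sumList-map : ∀ {B : Set} (xs : List B) (g : B → A) f →
                  sumList (map g xs) f ≈ sumList xs (f ∘ g)
    sumList-map []       g f = ≈-refl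
    sumList-map (b ∷ xs) g f = +-congˡ (sumList-map xs g f)

    sumList-*ˡ : ∀ (xs : List A) a f → sumList xs (λ v → a * f v) ≈ a * sumList xs f
    sumList-*ˡ []       a f = sym (zeroʳ a)
    sumList-*ˡ (v ∷ xs) a f = trans (+-congˡ (sumList-*ˡ xs a f)) (sym (distribˡ a _ _))

    sumList-zero : ∀ (xs : List A) → sumList xs (λ _ → 0#) ≈ 0#
    sumList-zero []       = ≈-refl
    sumList-zero (v ∷ xs) = trans (+-identityˡ _) (sumList-zero xs)

  ∑⊆ : ∀ n → (VSet n → Carrier) → Carrier
  ∑⊆ n = sumList (allSubsets n)

  ∑⊆-∷ : ∀ n b (f : VSet (suc n) → Carrier) →
         ∑⊆ (suc n) f ≈ ∑⊆ n (λ A → f (b ∷ A)) + ∑⊆ n (λ A → f (not b ∷ A))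
  ∑⊆-∷ n false f = trans (sumList-++ (map (false ∷_) (allSubsets n)) _ f)
    (+-cong (sumList-map (allSubsets n) _ f) (sumList-map (allSubsets n) _ f))
  ∑⊆-∷ n true  f = trans (∑⊆-∷ n false f) (+-comm _ _)

  ∑⊆-++ : ∀ m n (f : VSet (m ℕ.+ n) → Carrier) →
          ∑⊆ (m ℕ.+ n) f ≈ ∑⊆ m (λ L → ∑⊆ n (λ M → f (L ++ᵥ M)))
  ∑⊆-++ zero    n f = sym (+-identityʳ _)
  ∑⊆-++ (suc m) n f = begin
    ∑⊆ (suc m ℕ.+ n) f
      ≈⟨ ∑⊆-∷ (m ℕ.+ n) false f ⟩
    ∑⊆ (m ℕ.+ n) (λ A → f (false ∷ A)) + ∑⊆ (m ℕ.+ n) (λ A → f (true ∷ A))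
      ≈⟨ +-cong (∑⊆-++ m n (λ A → f (false ∷ A))) (∑⊆-++ m n (λ A → f (true ∷ A))) ⟩
    ∑⊆ m (λ L → ∑⊆ n (λ M → f (false ∷ L ++ᵥ M))) + ∑⊆ m (λ L → ∑⊆ n (λ M → f (true ∷ L ++ᵥ M)))
      ≈⟨ ∑⊆-∷ m false (λ L → ∑⊆ n (λ M → f (L ++ᵥ M))) ⟨
    ∑⊆ (suc m) (λ L → ∑⊆ n (λ M → f (L ++ᵥ M))) ∎

  ∑⊆-∏ : ∀ n (f : Fin n → Bool → Carrier) →
         ∑⊆ n (λ A → ∏ (λ i → f i (lookup A i))) ≈ ∏ (λ i → f i false + f i true)
  ∑⊆-∏ zero    f = +-identityʳ 1#
  ∑⊆-∏ (suc n) f = begin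
    ∑⊆ (suc n) (λ A → ∏ (λ i → f i (lookup A i)))
      ≈⟨ ∑⊆-∷ n false _ ⟩
    ∑⊆ n (λ A → f zero false * rest A) + ∑⊆ n (λ A → f zero true * rest A)
      ≈⟨ +-cong (sumList-*ˡ (allSubsets n) _ rest) (sumList-*ˡ (allSubsets n) _ rest) ⟩
    f zero false * ∑⊆ n rest + f zero true * ∑⊆ n rest
      ≈⟨ distribʳ _ _ _ ⟨
    (f zero false + f zero true) * ∑⊆ n rest
      ≈⟨ *-congˡ (∑⊆-∏ n (f ∘ suc)) ⟩
    ∏ (λ i → f i false + f i true) ∎
    where
    rest : VSet n → Carrier
    rest A = ∏ (λ i → f (suc i) (lookup A i))

  ∑⊆-∏∏ : ∀ m n (f : Fin m → Fin n → Bool → Carrier) →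
          ∑⊆ (m ℕ.* n) (λ A → ∏ (λ i → ∏ (λ j → f i j (lookup A (combine i j)))))
          ≈ ∏ (λ i → ∏ (λ j → f i j false + f i j true))
  ∑⊆-∏∏ m n f = begin
    ∑⊆ (m ℕ.* n) (λ A → ∏ (λ i → ∏ (λ j → f i j (lookup A (combine i j)))))
      ≈⟨ sumList-cong (allSubsets (m ℕ.* n)) (λ A → reindex (λ w → F w (lookup A w))
                                              (λ i j → F-combine i j (lookup A (combine i j)))) ⟨
    ∑⊆ (m ℕ.* n) (λ A → ∏ (λ w → F w (lookup A w)))
      ≈⟨ ∑⊆-∏ (m ℕ.* n) F ⟩
    ∏ (λ w → F w false + F w true)
      ≈⟨ reindex (λ w → F w false + F w true)
                 (λ i j → +-cong (F-combine i j false) (F-combine i j true)) ⟩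
    ∏ (λ i → ∏ (λ j → f i j false + f i j true)) ∎
    where
    F : Fin (m ℕ.* n) → Bool → Carrier
    F w = uncurry f (remQuot n w)
    F-combine : ∀ i j b → F (combine i j) b ≈ f i j b
    F-combine i j b = reflexive (cong (λ ij → uncurry f ij b) (remQuot-combine i j))
    reindex : ∀ (g : Fin (m ℕ.* n) → Carrier) {h : Fin m → Fin n → Carrier} →
              (∀ i j → g (combine i j) ≈ h i j) → ∏ g ≈ ∏ (λ i → ∏ (h i))
    reindex g g≈h = trans (sum-combine *-monoid m n g) (∏-cong λ i → ∏-cong (g≈h i))

  gadgetWeight : ∀ {K} → (Bool → Carrier) → (Bool → Bool → Carrier) →
                 Bool → (Fin K → Bool) → Carrier
  gadgetWeight c φ l μ = c l * ∏ (λ k → φ l (μ k))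

  gadgetSum : ℕ → (Bool → Carrier) → (Bool → Bool → Carrier) → Bool → Carrier
  gadgetSum K c φ l = c l * pow R (φ l false + φ l true) K

  -- A subset of Fin (p + p * K) lists p leaf bits followed by the K middle bits of each
  -- leaf, blocked by combine, as in the numbering of T.
  allGadgetsWeight : ∀ p K → (Bool → Carrier) → (Bool → Bool → Carrier) →
                     VSet (p ℕ.+ p ℕ.* K) → Carrier
  allGadgetsWeight p K c φ A =
    ∏ (λ j → gadgetWeight c φ (lookup A (j ↑ˡ p ℕ.* K)) (λ k → lookup A (p ↑ʳ combine j k)))

  ∑⊆-allGadgets : ∀ p K (c : Bool → Carrier) (φ : Bool → Bool → Carrier) →
    ∑⊆ (p ℕ.+ p ℕ.* K) (allGadgetsWeight p K c φ)
    ≈ pow R (gadgetSum K c φ false + gadgetSum K c φ true) p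
  ∑⊆-allGadgets p K c φ = begin
    ∑⊆ (p ℕ.+ p ℕ.* K) (allGadgetsWeight p K c φ)
      ≈⟨ ∑⊆-++ p (p ℕ.* K) _ ⟩
    ∑⊆ p (λ L → ∑⊆ (p ℕ.* K) (λ M → ∏ (λ j → gadgetWeight c φ (lookup (L ++ᵥ M) (j ↑ˡ p ℕ.* K))
                                                          (λ k → lookup (L ++ᵥ M) (p ↑ʳ combine j k)))))
      ≈⟨ sumList-cong (allSubsets p) (λ L → sumList-cong (allSubsets (p ℕ.* K)) (λ M →
           ∏-cong λ j → *-cong (reflexive (cong c (lookup-++ˡ L M j)))
                               (∏-cong λ k → reflexive (cong₂ φ (lookup-++ˡ L M j)
                                                                (lookup-++ʳ L M (combine j k)))))) ⟩
    ∑⊆ p (λ L → ∑⊆ (p ℕ.* K) (λ M → ∏ (λ j → gadgetWeight c φ (lookup L j)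
                                                             (λ k → lookup M (combine j k)))))
      ≈⟨ sumList-cong (allSubsets p) (λ L → independent-gadgets (lookup L)) ⟩
    ∑⊆ p (λ L → ∏ (λ j → gadgetSum K c φ (lookup L j)))
      ≈⟨ ∑⊆-∏ p (λ _ → gadgetSum K c φ) ⟩
    ∏ {p} (λ _ → gadgetSum K c φ false + gadgetSum K c φ true)
      ≈⟨ ∏-const p _ ⟩
    pow R (gadgetSum K c φ false + gadgetSum K c φ true) p ∎
    where
    independent-gadgets : (l : Fin p → Bool) →
      ∑⊆ (p ℕ.* K) (λ M → ∏ (λ j → gadgetWeight c φ (l j) (λ k → lookup M (combine j k))))
      ≈ ∏ (λ j → gadgetSum K c φ (l j))
    independent-gadgets l = begin
      ∑⊆ (p ℕ.* K) (λ M → ∏ (λ j → gadgetWeight c φ (l j) (λ k → lookup M (combine j k))))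
        ≈⟨ sumList-cong (allSubsets (p ℕ.* K)) (λ M → ∏-distrib-* (c ∘ l)
             (λ j → ∏ (λ k → φ (l j) (lookup M (combine j k))))) ⟩
      ∑⊆ (p ℕ.* K) (λ M → ∏ (c ∘ l) * midProduct M)
        ≈⟨ sumList-*ˡ (allSubsets (p ℕ.* K)) _ midProduct ⟩
      ∏ (c ∘ l) * ∑⊆ (p ℕ.* K) midProduct
        ≈⟨ *-congˡ (∑⊆-∏∏ p K (λ j k → φ (l j))) ⟩
      ∏ (c ∘ l) * ∏ (λ j → ∏ {K} (λ k → φ (l j) false + φ (l j) true))
        ≈⟨ *-congˡ (∏-cong {p} λ j → ∏-const K (φ (l j) false + φ (l j) true)) ⟩
      ∏ (c ∘ l) * ∏ (λ j → pow R (φ (l j) false + φ (l j) true) K)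
        ≈⟨ ∏-distrib-* (c ∘ l) (λ j → pow R (φ (l j) false + φ (l j) true) K) ⟨
      ∏ (λ j → gadgetSum K c φ (l j)) ∎
      where
      midProduct : VSet (p ℕ.* K) → Carrier
      midProduct M = ∏ (λ j → ∏ (λ k → φ (l j) (lookup M (combine j k))))

  module _ (x y z : Carrier) where

    monomial : ℕ → ℕ → ℕ → Carrier
    monomial e d f = pow R x e * pow R y d * pow R z f

    monomial-+ : ∀ e e′ d d′ f f′ →
      monomial (e ℕ.+ e′) (d ℕ.+ d′) (f ℕ.+ f′) ≈ monomial e d f * monomial e′ d′ f′
    monomial-+ e e′ d d′ f f′ = trans (*-cong (*-cong (pow-+ x e e′) (pow-+ y d d′)) (pow-+ z f f′))
      (solve-* 6 (λ a a′ b b′ c c′ → ((a ⊕ a′) ⊕ (b ⊕ b′)) ⊕ (c ⊕ c′)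
                                    ⊜ ((a ⊕ b) ⊕ c) ⊕ ((a′ ⊕ b′) ⊕ c′)) ≈-refl _ _ _ _ _ _)
      where open *-Solver using (_⊕_; _⊜_) renaming (solve to solve-*)

    monomial-∑ : ∀ {n} (e d f : Fin n → ℕ) →
      monomial (sum e) (sum d) (sum f) ≈ ∏ (λ i → monomial (e i) (d i) (f i))
    monomial-∑ {zero}  e d f = trans (*-identityʳ _) (*-identityʳ _)
    monomial-∑ {suc n} e d f = trans (monomial-+ (e zero) _ (d zero) _ (f zero) _)
                                     (*-congˡ (monomial-∑ (e ∘ suc) (d ∘ suc) (f ∘ suc)))

    leafWeight : Bool → Carrier
    leafWeight l = monomial 0 (indicator l) 0

    -- a middle vertex in state b whose neighbours, the center and its leaf, are in states a, l
    vertexWeight : Bool → Bool → Bool → Carrier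
    vertexWeight a l b = monomial (indicator (a ∧ b) ℕ.+ indicator (l ∧ b)) (indicator b)
                                  (indicator (not a ∧ not b) ℕ.+ indicator (not l ∧ not b))

    monomial-gadget : ∀ {K} a l (μ : Fin K → Bool) →
      monomial (gadgetEdges a l μ) (gadgetSize l μ) (gadgetEdges (not a) (not l) (not ∘ μ))
      ≈ gadgetWeight leafWeight (vertexWeight a) l μ
    monomial-gadget {K} a l μ = trans
      (monomial-+ 0 (gadgetEdges a l μ) (indicator l) (∑[ k < K ] indicator (μ k))
                  0 (gadgetEdges (not a) (not l) (not ∘ μ)))
      (*-congˡ (monomial-∑
      (λ k → indicator (a ∧ μ k) ℕ.+ indicator (l ∧ μ k))
      (λ k → indicator (μ k))
      (λ k → indicator (not a ∧ not (μ k)) ℕ.+ indicator (not l ∧ not (μ k)))))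

    module _ (ℓ q : ℕ) where
      private
        p K N : ℕ
        p = 2 ℕ.* q
        K = 4 ℕ.* ℓ
        N = p ℕ.+ p ℕ.* K

      Z-weight Z-term : Bool → VSet (Tsize ℓ q) → Carrier
      Z-weight b A =
        monomial (edgesIn (T ℓ q) A) (diffSize A (centerIf b)) (edgesIn (T ℓ q) (compl A))
      Z-term b A = if admissible (centerIf b) (centerIf (not b)) A then Z-weight b A else 0#

      Z-term-in : ∀ b (A : VSet N) →
        Z-term b (b ∷ A) ≈ allGadgetsWeight p K leafWeight (vertexWeight b) A
      Z-term-in b A = begin
        Z-term b (b ∷ A)
          ≡⟨ cong (λ t → if t then Z-weight b (b ∷ A) else 0#) (admissible-in b A) ⟩
        monomial (edgesIn (T ℓ q) (b ∷ A)) (diffSize (b ∷ A) (centerIf b))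
                 (edgesIn (T ℓ q) (compl (b ∷ A)))
          ≡⟨ cong₂ (λ e d → monomial e d (edgesIn (T ℓ q) (compl (b ∷ A))))
                   (edgesIn-T ℓ q (b ∷ A))
                   (≡.trans (diffSize-T ℓ q b (b ∷ A))
                            (cong (λ t → indicator t ℕ.+ sum sizes) (∧-inverseʳ b))) ⟩
        monomial (sum edges) (sum sizes) (edgesIn (T ℓ q) (compl (b ∷ A)))
          ≡⟨ cong (monomial (sum edges) (sum sizes)) (edgesIn-compl-T ℓ q (b ∷ A)) ⟩
        monomial (sum edges) (sum sizes) (sum complEdges)
          ≈⟨ monomial-∑ edges sizes complEdges ⟩
        ∏ (λ j → monomial (edges j) (sizes j) (complEdges j))
          ≈⟨ ∏-cong (λ j → monomial-gadget b (leafBit j) (midBits j)) ⟩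
        ∏ (λ j → gadgetWeight leafWeight (vertexWeight b) (leafBit j) (midBits j)) ∎
        where
        leafBit : Fin p → Bool
        leafBit j = lookup A (j ↑ˡ p ℕ.* K)
        midBits : Fin p → Fin K → Bool
        midBits j k = lookup A (p ↑ʳ combine j k)
        edges sizes complEdges : Fin p → ℕ
        edges j = gadgetEdges b (leafBit j) (midBits j)
        sizes j = gadgetSize (leafBit j) (midBits j)
        complEdges j = gadgetEdges (not b) (not (leafBit j)) (not ∘ midBits j)

      Z-term-out : ∀ b (A : VSet N) → Z-term b (not b ∷ A) ≈ 0#
      Z-term-out b A =
        reflexive (cong (λ t → if t then Z-weight b (not b ∷ A) else 0#) (admissible-out b A))

      Z-T : ∀ b → Z R (T ℓ q) (centerIf b) (centerIf (not b)) x y z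
                  ≈ pow R (gadgetSum K leafWeight (vertexWeight b) false
                           + gadgetSum K leafWeight (vertexWeight b) true) p
      Z-T b = begin
        ∑⊆ (suc N) (Z-term b)
          ≈⟨ ∑⊆-∷ N b (Z-term b) ⟩
        ∑⊆ N (λ A → Z-term b (b ∷ A)) + ∑⊆ N (λ A → Z-term b (not b ∷ A))
          ≈⟨ +-cong (sumList-cong (allSubsets N) (Z-term-in b))
                    (trans (sumList-cong (allSubsets N) (Z-term-out b))
                           (sumList-zero (allSubsets N))) ⟩
        ∑⊆ N (allGadgetsWeight p K leafWeight (vertexWeight b)) + 0#
          ≈⟨ +-identityʳ _ ⟩
        ∑⊆ N (allGadgetsWeight p K leafWeight (vertexWeight b))
          ≈⟨ ∑⊆-allGadgets p K leafWeight (vertexWeight b) ⟩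
        pow R (gadgetSum K leafWeight (vertexWeight b) false
               + gadgetSum K leafWeight (vertexWeight b) true) p ∎

      gadgetSums≈g : gadgetSum K leafWeight (vertexWeight true) false
                     + gadgetSum K leafWeight (vertexWeight true) true ≈ g R ℓ x y z
      gadgetSums≈g = trans
        (+-cong (*-congˡ (pow-cong K leafOut)) (*-congˡ (pow-cong K leafIn)))
        (solve 3 (λ y P Q → con 1 :* con 1 :* con 1 :* P :+ con 1 :* (y :* con 1) :* con 1 :* Q
                            := y :* Q :+ P) ≈-refl y _ _)
        where
        leafOut : vertexWeight true false false + vertexWeight true false true ≈ y * x + z
        leafOut = solve 3 (λ x y z → con 1 :* con 1 :* (z :* con 1)
                                     :+ (x :* con 1) :* (y :* con 1) :* con 1 := y :* x :+ z) ≈-refl x y z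
        leafIn : vertexWeight true true false + vertexWeight true true true ≈ y * pow R x 2 + 1#
        leafIn = solve 2 (λ x y → con 1 :* con 1 :* con 1 :+ (x :* (x :* con 1)) :* (y :* con 1) :* con 1
                                  := y :* (x :* (x :* con 1)) :+ con 1) ≈-refl x y

      gadgetSums≈h : gadgetSum K leafWeight (vertexWeight false) false
                     + gadgetSum K leafWeight (vertexWeight false) true ≈ h R ℓ x y z
      gadgetSums≈h = trans
        (+-cong (*-congˡ (pow-cong K leafOut)) (*-congˡ (pow-cong K leafIn)))
        (solve 3 (λ y P Q → con 1 :* con 1 :* con 1 :* P :+ con 1 :* (y :* con 1) :* con 1 :* Q
                            := P :+ y :* Q) ≈-refl y _ _)
        where
        leafOut : vertexWeight false false false + vertexWeight false false true ≈ y + pow R z 2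
        leafOut = solve 2 (λ y z → con 1 :* con 1 :* (z :* (z :* con 1))
                                   :+ con 1 :* (y :* con 1) :* con 1 := y :+ z :* (z :* con 1)) ≈-refl y z
        leafIn : vertexWeight false true false + vertexWeight false true true ≈ y * x + z
        leafIn = solve 3 (λ x y z → con 1 :* con 1 :* (z :* con 1)
                                    :+ (x :* con 1) :* (y :* con 1) :* con 1 := y :* x :+ z) ≈-refl x y z

-- The identity holds for all ℓ and q.
mainTheorem15 : ∀ {c ℓ′} (R : CommutativeSemiring c ℓ′) (ℓ q : ℕ) → ℓ ≥ 1 → q ≥ 1 →
    (x y z : CommutativeSemiring.Carrier R) →
    CommutativeSemiring._≈_ R (Z R (T ℓ q) (singleton (cT ℓ q)) ∅ x y z) (pow R (g R ℓ x y z) (2 Data.Nat.* q))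
    × CommutativeSemiring._≈_ R (Z R (T ℓ q) ∅ (singleton (cT ℓ q)) x y z) (pow R (h R ℓ x y z) (2 Data.Nat.* q))
mainTheorem15 R ℓ q _ _ x y z =
  trans (Z-T R x y z ℓ q true)  (pow-cong R (2 ℕ.* q) (gadgetSums≈g R x y z ℓ q)) ,
  trans (Z-T R x y z ℓ q false) (pow-cong R (2 ℕ.* q) (gadgetSums≈h R x y z ℓ q))
  where open CommutativeSemiring R using (trans)
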